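{- Let $n\ge 2$ be an integer, let $(U_r)_{r\in\mathbb{Z}}$ be the $n$-step Fibonacci numbers and let $(W_r)_{r\in\mathbb{Z}}$ be any generalized $n$-step Fibonacci sequence. Then for all integers $r$ and $s$, \[ W_{r+s}=\sum_{i=1}^{n}\left(\sum_{j=0}^{n-i}W_{s-j+1}\right)U_{r-i}. \]
   Context: For an integer $n\ge 2$, the $n$-step Fibonacci numbers $(U_r)_{r\in\mathbb{Z}}$ are the unique two-sided sequence satisfying $U_r=\sum_{i=1}^{n}U_{r-i}$ for all $r\in\mathbb{Z}$, with $U_k=0$ for $-n+2\le k\le 0$ and $U_{ -n+1}=1$. A generalized $n$-step Fibonacci sequence is any sequence $(W_r)_{r\in\mathbb{Z}}$ of complex numbers satisfying $W_r=\sum_{i=1}^{n}W_{r-i}$ for all $r\in\mathbb{Z}$. -}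

module Defs where

open import Level using (_⊔_)
open import Algebra.Bundles using (CommutativeRing)
open import Data.Nat as ℕ using (ℕ; zero; suc; _∸_; _≤_)
open import Data.Integer as ℤ using (ℤ)
open import Data.Product using (_×_)

module _ {c ℓ} (R : CommutativeRing c ℓ) where
  open CommutativeRing R

  ΣR : ℕ → (ℕ → Carrier) → Carrier
  ΣR zero    f = 0#
  ΣR (suc m) f = ΣR m f + f m

  IsGenFib : ℕ → (ℤ → Carrier) → Set ℓ
  IsGenFib n W = ∀ (r : ℤ) → W r ≈ ΣR n (λ k → W (r ℤ.- ℤ.+ (suc k)))

  IsNStepFib : ℕ → (ℤ → Carrier) → Set ℓ
  IsNStepFib n U =
    IsGenFib n U
    × (∀ (k : ℕ) → k ℕ.+ 2 ≤ n → U (ℤ.- ℤ.+ k) ≈ 0#)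
    × (U (ℤ.- ℤ.+ (n ∸ 1)) ≈ 1#)

-- Write S r s for the right-hand side and B t s = W (s + 1) + W s + … + W (s − t + 2)
-- for its inner block sums. Since B (t + 1) (s + 1) = W (s + 2) + B t s, the recurrences
-- of U and W give S (r − 1) (s + 1) = S r s: the first summands recombine to
-- W (s + 2) · U (r − 1) with W (s + 2) = B n s, and the rest shift by one index.
-- So S r s depends only on r + s, and the initial values of U give S 1 s = W (s + 1).
module Submission where

open import Defs
open import Algebra.Bundles using (CommutativeRing)
open import Data.Nat using (ℕ; suc; _∸_; _≤_)
open import Data.Integer as ℤ using (ℤ)
open import Data.Nat as ℕ using (zero; _<_; s≤s)
import Data.Nat.Properties as ℕ
import Data.Integer.Properties as ℤ
open import Data.Integer.Tactic.RingSolver using (solve-∀)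
open import Data.Product using (_,_)
open import Relation.Binary.Bundles using (Setoid)
open import Relation.Binary.PropositionalEquality as P using (_≡_)
import Algebra.Properties.CommutativeSemigroup as CommutativeSemigroupProperties
import Relation.Binary.Reasoning.Setoid as SetoidReasoning

module _ {c ℓ} (A : Setoid c ℓ) where
  open Setoid A
  open SetoidReasoning A

  antidiagonal-invariant : (g : ℤ → ℤ → Carrier) →
    (∀ r s → g (r ℤ.- ℤ.+ 1) (s ℤ.+ ℤ.+ 1) ≈ g r s) →
    ∀ r s r′ s′ → r ℤ.+ s ≡ r′ ℤ.+ s′ → g r s ≈ g r′ s′
  antidiagonal-invariant g shift r s r′ s′ eq = begin
    g r s              ≈⟨ to-origin r s ⟩
    g ℤ.0ℤ (r ℤ.+ s)   ≡⟨ P.cong (g ℤ.0ℤ) eq ⟩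
    g ℤ.0ℤ (r′ ℤ.+ s′) ≈⟨ to-origin r′ s′ ⟨
    g r′ s′            ∎
    where
    up : ∀ k s → g (ℤ.+ k) s ≈ g ℤ.0ℤ (ℤ.+ k ℤ.+ s)
    up zero    s = reflexive (P.cong (g ℤ.0ℤ) (P.sym (ℤ.+-identityˡ s)))
    up (suc k) s = begin
      g (ℤ.+ suc k) s                   ≈⟨ shift (ℤ.+ suc k) s ⟨
      g (ℤ.+ k) (s ℤ.+ ℤ.+ 1)           ≈⟨ up k (s ℤ.+ ℤ.+ 1) ⟩
      g ℤ.0ℤ (ℤ.+ k ℤ.+ (s ℤ.+ ℤ.+ 1))  ≡⟨ P.cong (g ℤ.0ℤ) (x+[y+1]≡[1+x]+y (ℤ.+ k) s) ⟩
      g ℤ.0ℤ (ℤ.+ suc k ℤ.+ s)          ∎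
      where
      x+[y+1]≡[1+x]+y : ∀ x y → x ℤ.+ (y ℤ.+ ℤ.+ 1) ≡ (ℤ.+ 1 ℤ.+ x) ℤ.+ y
      x+[y+1]≡[1+x]+y = solve-∀

    down : ∀ k s → g (ℤ.- ℤ.+ k) s ≈ g ℤ.0ℤ (ℤ.- ℤ.+ k ℤ.+ s)
    down zero    s = up zero s
    down (suc k) s = begin
      g (ℤ.- ℤ.+ suc k) s
        ≡⟨ P.cong₂ g (-x-1≡-[1+x] (ℤ.+ k)) (x-1+1≡x s) ⟨
      g (ℤ.- ℤ.+ k ℤ.- ℤ.+ 1) (s ℤ.- ℤ.+ 1 ℤ.+ ℤ.+ 1)
        ≈⟨ shift (ℤ.- ℤ.+ k) (s ℤ.- ℤ.+ 1) ⟩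
      g (ℤ.- ℤ.+ k) (s ℤ.- ℤ.+ 1)
        ≈⟨ down k (s ℤ.- ℤ.+ 1) ⟩
      g ℤ.0ℤ (ℤ.- ℤ.+ k ℤ.+ (s ℤ.- ℤ.+ 1))
        ≡⟨ P.cong (g ℤ.0ℤ) (-x+[y-1]≡-[1+x]+y (ℤ.+ k) s) ⟩
      g ℤ.0ℤ (ℤ.- ℤ.+ suc k ℤ.+ s) ∎
      where
      -x-1≡-[1+x] : ∀ x → ℤ.- x ℤ.- ℤ.+ 1 ≡ ℤ.- (ℤ.+ 1 ℤ.+ x)
      -x-1≡-[1+x] = solve-∀
      x-1+1≡x : ∀ x → x ℤ.- ℤ.+ 1 ℤ.+ ℤ.+ 1 ≡ x
      x-1+1≡x = solve-∀
      -x+[y-1]≡-[1+x]+y : ∀ x y → ℤ.- x ℤ.+ (y ℤ.- ℤ.+ 1) ≡ ℤ.- (ℤ.+ 1 ℤ.+ x) ℤ.+ y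
      -x+[y-1]≡-[1+x]+y = solve-∀

    to-origin : ∀ r s → g r s ≈ g ℤ.0ℤ (r ℤ.+ s)
    to-origin (ℤ.+ k)    s = up k s
    to-origin ℤ.-[1+ k ] s = down (suc k) s

module _ {c ℓ} (R : CommutativeRing c ℓ) where
  open CommutativeRing R
  open SetoidReasoning setoid
  open CommutativeSemigroupProperties +-commutativeSemigroup using (interchange)

  private
    Σ : ℕ → (ℕ → Carrier) → Carrier
    Σ = ΣR R

  ΣR-cong : ∀ t {f g : ℕ → Carrier} → (∀ k → k < t → f k ≈ g k) → Σ t f ≈ Σ t g
  ΣR-cong zero    f≈g = refl
  ΣR-cong (suc t) f≈g = +-cong (ΣR-cong t (λ k k<t → f≈g k (ℕ.m≤n⇒m≤1+n k<t))) (f≈g t ℕ.≤-refl)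

  ΣR-zero : ∀ t {f : ℕ → Carrier} → (∀ k → k < t → f k ≈ 0#) → Σ t f ≈ 0#
  ΣR-zero t {f} f≈0 = begin
    Σ t f          ≈⟨ ΣR-cong t f≈0 ⟩
    Σ t (λ _ → 0#) ≈⟨ ΣR-0# t ⟩
    0#             ∎
    where
    ΣR-0# : ∀ t → Σ t (λ _ → 0#) ≈ 0#
    ΣR-0# zero    = refl
    ΣR-0# (suc t) = trans (+-identityʳ _) (ΣR-0# t)

  ΣR-suc : ∀ t (f : ℕ → Carrier) → Σ (suc t) f ≈ f 0 + Σ t (λ k → f (suc k))
  ΣR-suc zero    f = trans (+-identityˡ _) (sym (+-identityʳ _))
  ΣR-suc (suc t) f = begin
    Σ (suc t) f + f (suc t)                     ≈⟨ +-congʳ (ΣR-suc t f) ⟩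
    (f 0 + Σ t (λ k → f (suc k))) + f (suc t)   ≈⟨ +-assoc _ _ _ ⟩
    f 0 + Σ (suc t) (λ k → f (suc k))           ∎

  ΣR-+ : ∀ t (f g : ℕ → Carrier) → Σ t (λ k → f k + g k) ≈ Σ t f + Σ t g
  ΣR-+ zero    f g = sym (+-identityʳ 0#)
  ΣR-+ (suc t) f g = trans (+-congʳ (ΣR-+ t f g)) (interchange _ _ _ _)

  ΣR-*ˡ : ∀ t a (f : ℕ → Carrier) → Σ t (λ k → a * f k) ≈ a * Σ t f
  ΣR-*ˡ zero    a f = sym (zeroʳ a)
  ΣR-*ˡ (suc t) a f = trans (+-congʳ (ΣR-*ˡ t a f)) (sym (distribˡ a _ _))

  module Expansion (m : ℕ) (U W : ℤ → Carrier) where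
    private
      n : ℕ
      n = suc m

    block : ℕ → ℤ → Carrier
    block t s = Σ t (λ j → W (s ℤ.- ℤ.+ j ℤ.+ ℤ.+ 1))

    expansion : ℤ → ℤ → Carrier
    expansion r s = Σ n (λ k → block (suc (n ∸ suc k)) s * U (r ℤ.- ℤ.+ suc k))

    W-cong : ∀ {x y} → x ≡ y → W x ≈ W y
    W-cong eq = reflexive (P.cong W eq)

    U-cong : ∀ {x y} → x ≡ y → U x ≈ U y
    U-cong eq = reflexive (P.cong U eq)

    block-suc : ∀ t s → block (suc t) (s ℤ.+ ℤ.+ 1) ≈ W (s ℤ.+ ℤ.+ 2) + block t s
    block-suc t s = trans (ΣR-suc t _)
      (+-cong (W-cong (x+1-0+1≡x+2 s)) (ΣR-cong t (λ j _ → W-cong (x+1-[1+y]+1≡x-y+1 s (ℤ.+ j)))))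
      where
      x+1-0+1≡x+2 : ∀ x → x ℤ.+ ℤ.+ 1 ℤ.- ℤ.+ 0 ℤ.+ ℤ.+ 1 ≡ x ℤ.+ ℤ.+ 2
      x+1-0+1≡x+2 = solve-∀
      x+1-[1+y]+1≡x-y+1 : ∀ x y → x ℤ.+ ℤ.+ 1 ℤ.- (ℤ.+ 1 ℤ.+ y) ℤ.+ ℤ.+ 1 ≡ x ℤ.- y ℤ.+ ℤ.+ 1
      x+1-[1+y]+1≡x-y+1 = solve-∀

    block-full : IsGenFib R n W → ∀ s → block n s ≈ W (s ℤ.+ ℤ.+ 2)
    block-full isFibW s = sym (trans (isFibW (s ℤ.+ ℤ.+ 2))
      (ΣR-cong n (λ j _ → W-cong (x+2-[1+y]≡x-y+1 s (ℤ.+ j)))))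
      where
      x+2-[1+y]≡x-y+1 : ∀ x y → x ℤ.+ ℤ.+ 2 ℤ.- (ℤ.+ 1 ℤ.+ y) ≡ x ℤ.- y ℤ.+ ℤ.+ 1
      x+2-[1+y]≡x-y+1 = solve-∀

    expansion-shift : IsGenFib R n U → IsGenFib R n W →
      ∀ r s → expansion (r ℤ.- ℤ.+ 1) (s ℤ.+ ℤ.+ 1) ≈ expansion r s
    expansion-shift isFibU isFibW r s = begin
      expansion (r ℤ.- ℤ.+ 1) (s ℤ.+ ℤ.+ 1)
        ≈⟨ ΣR-cong n (λ k _ → trans (*-congʳ (block-suc (m ∸ k) s)) (distribʳ _ _ _)) ⟩
      Σ n (λ k → w * u k + block (m ∸ k) s * u k)
        ≈⟨ ΣR-+ n _ _ ⟩
      Σ n (λ k → w * u k) + Σ n (λ k → block (m ∸ k) s * u k)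
        ≈⟨ +-cong (trans (ΣR-*ˡ n w u) (*-congˡ (sym (isFibU (r ℤ.- ℤ.+ 1))))) drop-last ⟩
      w * U (r ℤ.- ℤ.+ 1) + Σ m (λ k → block (m ∸ k) s * U (r ℤ.- ℤ.+ suc (suc k)))
        ≈⟨ +-cong (*-congʳ (sym (block-full isFibW s))) (ΣR-cong m lengths) ⟩
      block n s * U (r ℤ.- ℤ.+ 1)
        + Σ m (λ k → block (suc (m ∸ suc k)) s * U (r ℤ.- ℤ.+ suc (suc k)))
        ≈⟨ ΣR-suc m _ ⟨
      expansion r s ∎
      where
      w : Carrier
      w = W (s ℤ.+ ℤ.+ 2)

      u : ℕ → Carrier
      u k = U ((r ℤ.- ℤ.+ 1) ℤ.- ℤ.+ suc k)

      x-1-[1+y]≡x-[1+[1+y]] : ∀ x y → x ℤ.- ℤ.+ 1 ℤ.- (ℤ.+ 1 ℤ.+ y) ≡ x ℤ.- (ℤ.+ 1 ℤ.+ (ℤ.+ 1 ℤ.+ y))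
      x-1-[1+y]≡x-[1+[1+y]] = solve-∀

      -- the last summand contains the empty block (m ∸ m = 0)
      drop-last : Σ n (λ k → block (m ∸ k) s * u k)
                ≈ Σ m (λ k → block (m ∸ k) s * U (r ℤ.- ℤ.+ suc (suc k)))
      drop-last = begin
        Σ m (λ k → block (m ∸ k) s * u k) + block (m ∸ m) s * u m
          ≈⟨ +-cong (ΣR-cong m (λ k _ → *-congˡ (U-cong (x-1-[1+y]≡x-[1+[1+y]] r (ℤ.+ k)))))
                    (trans (*-congʳ (reflexive (P.cong (λ t → block t s) (ℕ.n∸n≡0 m))))
                           (zeroˡ _)) ⟩
        Σ m (λ k → block (m ∸ k) s * U (r ℤ.- ℤ.+ suc (suc k))) + 0#
          ≈⟨ +-identityʳ _ ⟩
        Σ m (λ k → block (m ∸ k) s * U (r ℤ.- ℤ.+ suc (suc k))) ∎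

      lengths : ∀ k → k < m → block (m ∸ k) s * U (r ℤ.- ℤ.+ suc (suc k))
                            ≈ block (suc (m ∸ suc k)) s * U (r ℤ.- ℤ.+ suc (suc k))
      lengths k k<m = *-congʳ (reflexive (P.cong (λ t → block t s) (ℕ.+-∸-assoc 1 k<m)))

    expansion-one : (∀ k → k ℕ.+ 2 ≤ n → U (ℤ.- ℤ.+ k) ≈ 0#) → U (ℤ.- ℤ.+ m) ≈ 1# →
      ∀ s → expansion (ℤ.+ 1) s ≈ W (s ℤ.+ ℤ.+ 1)
    expansion-one U-zeros U-one s = begin
      expansion (ℤ.+ 1) s
        ≈⟨ +-cong (ΣR-zero m vanish) (*-congʳ (reflexive (P.cong (λ t → block (suc t) s) (ℕ.n∸n≡0 m)))) ⟩
      0# + block 1 s * U (ℤ.+ 1 ℤ.- ℤ.+ suc m)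
        ≈⟨ +-identityˡ _ ⟩
      block 1 s * U (ℤ.+ 1 ℤ.- ℤ.+ suc m)
        ≈⟨ *-cong (trans (+-identityˡ _) (W-cong (P.cong (ℤ._+ ℤ.+ 1) (ℤ.+-identityʳ s))))
                  (trans (U-cong (1-[1+x]≡-x (ℤ.+ m))) U-one) ⟩
      W (s ℤ.+ ℤ.+ 1) * 1#
        ≈⟨ *-identityʳ _ ⟩
      W (s ℤ.+ ℤ.+ 1) ∎
      where
      1-[1+x]≡-x : ∀ x → ℤ.+ 1 ℤ.- (ℤ.+ 1 ℤ.+ x) ≡ ℤ.- x
      1-[1+x]≡-x = solve-∀

      vanish : ∀ k → k < m → block (suc (n ∸ suc k)) s * U (ℤ.+ 1 ℤ.- ℤ.+ suc k) ≈ 0#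
      vanish k k<m = trans (*-congˡ (trans (U-cong (1-[1+x]≡-x (ℤ.+ k))) (U-zeros k k+2≤n))) (zeroʳ _)
        where
        k+2≤n : k ℕ.+ 2 ≤ n
        k+2≤n = P.subst (_≤ n) (ℕ.+-comm 2 k) (s≤s k<m)

corollary1 : ∀ {c ℓ} (R : CommutativeRing c ℓ) (n : ℕ) → 2 ≤ n →
  (U W : ℤ → CommutativeRing.Carrier R) →
  IsNStepFib R n U → IsGenFib R n W →
  ∀ (r s : ℤ) →
    let open CommutativeRing R in
    W (r ℤ.+ s) ≈ ΣR R n (λ k →
      ΣR R (suc (n ∸ suc k)) (λ j → W (s ℤ.- ℤ.+ j ℤ.+ ℤ.+ 1)) * U (r ℤ.- ℤ.+ suc k))
corollary1 R (suc m) _ U W (isFibU , U-zeros , U-one) isFibW r s = begin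
  W (r ℤ.+ s)                      ≡⟨ P.cong W (x+y≡[x+y-1]+1 r s) ⟩
  W (t ℤ.+ ℤ.+ 1)                  ≈⟨ expansion-one U-zeros U-one t ⟨
  expansion (ℤ.+ 1) t              ≈⟨ antidiagonal-invariant setoid expansion
                                        (expansion-shift isFibU isFibW) (ℤ.+ 1) t r s
                                        (P.sym (x+y≡1+[x+y-1] r s)) ⟩
  expansion r s                    ∎
  where
  open CommutativeRing R using (setoid)
  open SetoidReasoning setoid
  open Expansion R m U W

  t : ℤ
  t = r ℤ.+ s ℤ.- ℤ.+ 1

  x+y≡[x+y-1]+1 : ∀ x y → x ℤ.+ y ≡ x ℤ.+ y ℤ.- ℤ.+ 1 ℤ.+ ℤ.+ 1
  x+y≡[x+y-1]+1 = solve-∀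

  x+y≡1+[x+y-1] : ∀ x y → x ℤ.+ y ≡ ℤ.+ 1 ℤ.+ (x ℤ.+ y ℤ.- ℤ.+ 1)
  x+y≡1+[x+y-1] = solve-∀
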